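{- Let $T$ be a tournament with $n$ vertices and $t$ directed triangles such that $3t\geq n$. Then $\alpha(T)\geq \frac{2}{3}n\sqrt{\frac{n}{3t}}$.
   Context: A vertex set of a digraph is acyclic if its induced subdigraph has no directed cycle; $\alpha(T)$ is the maximum size of an acyclic vertex set of $T$. -}

module Defs where

open import Data.Nat using (ℕ; _+_; _*_; _<ᵇ_; _≤_)
open import Data.Bool using (Bool; true; false; _∧_; _∨_; if_then_else_)
open import Data.Fin using (Fin; toℕ)
open import Data.Fin.Subset using (Subset; _∈_; ∣_∣)
open import Data.List using (List; map)
open import Data.Nat.ListAction using (sum)
open import Data.List using () renaming (allFin to allFinL)
open import Data.Product using (∃; _×_)
open import Data.Sum using (_⊎_)
open import Relation.Binary.PropositionalEquality using (_≡_; _≢_)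
open import Relation.Nullary using (¬_)

record Tournament (n : ℕ) : Set where
  field
    arc     : Fin n → Fin n → Bool
    irrefl  : ∀ i → arc i i ≡ false
    total   : ∀ i j → i ≢ j → arc i j ≡ true ⊎ arc j i ≡ true
    antisym : ∀ i j → arc i j ≡ true → arc j i ≡ false
open Tournament public

isDirTriangle : ∀ {n} → Tournament n → Fin n → Fin n → Fin n → Bool
isDirTriangle T i j k =
  (arc T i j ∧ arc T j k ∧ arc T k i) ∨ (arc T i k ∧ arc T k j ∧ arc T j i)

triangles : ∀ {n} → Tournament n → ℕ
triangles {n} T =
  sum (map (λ i → sum (map (λ j → sum (map (λ k →
    if (toℕ i <ᵇ toℕ j) ∧ (toℕ j <ᵇ toℕ k) ∧ isDirTriangle T i j k
    then 1 else 0) (allFinL n))) (allFinL n))) (allFinL n))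

-- Directed walks inside the induced subdigraph T[S] (at least one arc).
data WalkIn {n : ℕ} (T : Tournament n) (S : Subset n) : Fin n → Fin n → Set where
  edge : ∀ {u v} → u ∈ S → v ∈ S → arc T u v ≡ true → WalkIn T S u v
  step : ∀ {u w v} → u ∈ S → arc T u w ≡ true → WalkIn T S w v → WalkIn T S u v

HasDirCycleIn : ∀ {n} → Tournament n → Subset n → Set
HasDirCycleIn T S = ∃ λ u → WalkIn T S u u

Acyclic : ∀ {n} → Tournament n → Subset n → Set
Acyclic T S = ¬ HasDirCycleIn T S

IsAlpha : ∀ {n} → Tournament n → ℕ → Set
IsAlpha {n} T a =
  (∃ λ (S : Subset n) → Acyclic T S × ∣ S ∣ ≡ a)
  × (∀ (S : Subset n) → Acyclic T S → ∣ S ∣ ≤ a)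

module Submission where

-- Proof by greedy deletion.  While the current vertex set S (of size s)
-- spans τ > 0 directed triangles, delete a vertex lying in the most of them;
-- by averaging it lies in at least 3τ/s.  Once no directed triangle is left
-- the set is transitive, hence acyclic.  Each deletion preserves the
-- arithmetic invariant `Bound`: s ≤ a + τ, and 4s³ ≤ 27τa² whenever s ≤ 3τ.

open import Defs
open import Data.Nat using (ℕ; zero; suc; _+_; _*_; _^_; _≤_; _<_; _<ᵇ_; z≤n; s≤s; z<s; _≤?_; _≟_; NonZero)
open import Data.Nat.Properties
open import Data.Bool using (Bool; true; false; _∧_; _∨_; if_then_else_)
open import Data.Fin using (Fin; toℕ; punchIn) renaming (zero to fzero; suc to fsuc)
import Data.Fin.Properties as Fin
open import Data.Product using (∃; _×_; _,_; proj₂)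
open import Data.Empty using (⊥-elim)
open import Function using (_∘_)
open import Relation.Binary.PropositionalEquality
open import Data.Nat.Tactic.RingSolver using (solve-∀)
import Data.List as List
open import Data.List.Extrema ≤-totalOrder using (argmax; f[xs]≤f[argmax])
open import Data.List.Membership.Propositional.Properties using (∈-allFin)
import Data.List.Relation.Unary.All as All
open import Relation.Nullary using (¬_; yes; no; does)
open import Relation.Nullary.Decidable using (dec-true; dec-false)
open import Data.Vec using ([]; _∷_; lookup; _[_]≔_)
open import Data.Vec.Properties using (lookup∘update; lookup∘update′; []≔-lookup; lookup-replicate; []=⇒lookup)
open import Data.Fin.Subset using (Subset; ∣_∣; ⊤; _∈_)
open import Data.Fin.Subset.Properties using (∣⊤∣≡n)
open import Data.Bool.Properties using (T-≡; ∧-comm; ∧-assoc; ∨-comm)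
open import Data.Sum using (inj₁; inj₂)
open import Function.Bundles using (Equivalence)
open import Relation.Binary.Definitions using (tri<; tri≈; tri>)
import Data.Nat.ListAction as ListSum
open import Data.List.Properties using (map-tabulate)
open import Algebra.Properties.Semiring.Sum +-*-semiring
  using (sum; sum-syntax; sum-cong-≗; ∑-distrib-+; ∑-comm; sum-remove; sum-replicate-zero;
         *-distribˡ-sum; *-distribʳ-sum)

∑-mono : ∀ {n} {f g : Fin n → ℕ} → (∀ i → f i ≤ g i) → sum f ≤ sum g
∑-mono {zero}  f≤g = z≤n
∑-mono {suc n} f≤g = +-mono-≤ (f≤g fzero) (∑-mono (f≤g ∘ fsuc))

∑≡0⇒≡0 : ∀ {n} (f : Fin n → ℕ) → sum f ≡ 0 → ∀ i → f i ≡ 0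
∑≡0⇒≡0 f ∑f≡0 fzero    = m+n≡0⇒m≡0 (f fzero) ∑f≡0
∑≡0⇒≡0 f ∑f≡0 (fsuc i) = ∑≡0⇒≡0 (f ∘ fsuc) (m+n≡0⇒n≡0 (f fzero) ∑f≡0) i

∑-single : ∀ {n} (f : Fin n → ℕ) i → (∀ j → j ≢ i → f j ≡ 0) → sum f ≡ f i
∑-single {suc n} f i off = begin
  sum f                      ≡⟨ sum-remove {i = i} f ⟩
  f i + sum (f ∘ punchIn i)  ≡⟨ cong (f i +_) (sum-cong-≗ (λ j → off _ (Fin.punchInᵢ≢i i j))) ⟩
  f i + sum {n} (λ _ → 0)    ≡⟨ cong (f i +_) (sum-replicate-zero n) ⟩
  f i + 0                    ≡⟨ +-identityʳ (f i) ⟩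
  f i                        ∎
  where open ≡-Reasoning

maximiser : ∀ {n} (f : Fin n → ℕ) → sum f ≢ 0 → ∃ λ v → ∀ w → f w ≤ f v
maximiser {zero}  f ∑f≢0 = ⊥-elim (∑f≢0 refl)
maximiser {suc n} f _    = argmax f fzero (List.allFin (suc n)) ,
  λ w → All.lookup (f[xs]≤f[argmax] {f = f} fzero (List.allFin (suc n))) (∈-allFin w)

listsum-allFin : ∀ {n} (f : Fin n → ℕ) → ListSum.sum (List.map f (List.allFin n)) ≡ sum f
listsum-allFin {n} f = trans (cong ListSum.sum (map-tabulate (λ i → i) f)) (listsum-tabulate f)
  where
    listsum-tabulate : ∀ {m} (g : Fin m → ℕ) → ListSum.sum (List.tabulate g) ≡ sum g
    listsum-tabulate {zero}  g = refl
    listsum-tabulate {suc m} g = cong (g fzero +_) (listsum-tabulate (g ∘ fsuc))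

⟦_⟧ : Bool → ℕ
⟦ b ⟧ = if b then 1 else 0

δ : ∀ {n} → Fin n → Fin n → ℕ
δ i v = ⟦ does (i Fin.≟ v) ⟧

∑-δ : ∀ {n} (i : Fin n) → (∑[ v < n ] δ i v) ≡ 1
∑-δ i = trans (∑-single (δ i) i off) (cong ⟦_⟧ (dec-true (i Fin.≟ i) refl))
  where
    off : ∀ v → v ≢ i → δ i v ≡ 0
    off v v≢i = cong ⟦_⟧ (dec-false (i Fin.≟ v) (≢-sym v≢i))

∑³ : ∀ {n} → (Fin n → Fin n → Fin n → ℕ) → ℕ
∑³ {n} f = ∑[ i < n ] ∑[ j < n ] ∑[ k < n ] f i j k

module _ {n : ℕ} where
  ∑³-cong : {f g : Fin n → Fin n → Fin n → ℕ} → (∀ i j k → f i j k ≡ g i j k) → ∑³ f ≡ ∑³ g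
  ∑³-cong f≡g = sum-cong-≗ {n} λ i → sum-cong-≗ {n} λ j → sum-cong-≗ {n} λ k → f≡g i j k

  ∑³-distrib-+ : (f g : Fin n → Fin n → Fin n → ℕ) →
                 ∑³ (λ i j k → f i j k + g i j k) ≡ ∑³ f + ∑³ g
  ∑³-distrib-+ f g = trans (sum-cong-≗ {n} λ i →
      trans (sum-cong-≗ {n} λ j → ∑-distrib-+ (f i j) (g i j)) (∑-distrib-+ {n} _ _))
    (∑-distrib-+ {n} _ _)

  ∑³-distribˡ-* : (c : ℕ) (f : Fin n → Fin n → Fin n → ℕ) → ∑³ (λ i j k → c * f i j k) ≡ c * ∑³ f
  ∑³-distribˡ-* c f = sym (trans (*-distribˡ-sum {n} c _) (sum-cong-≗ {n} λ i →
      trans (*-distribˡ-sum {n} c _) (sum-cong-≗ {n} λ j → *-distribˡ-sum c (f i j))))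

  ∑³≡0⇒≡0 : (f : Fin n → Fin n → Fin n → ℕ) → ∑³ f ≡ 0 → ∀ i j k → f i j k ≡ 0
  ∑³≡0⇒≡0 f ∑³f≡0 i j k =
    ∑≡0⇒≡0 (f i j) (∑≡0⇒≡0 (λ j → ∑[ k < n ] f i j k)
      (∑≡0⇒≡0 (λ i → ∑[ j < n ] ∑[ k < n ] f i j k) ∑³f≡0 i) j) k

  ∑-∑³-comm : (f : Fin n → Fin n → Fin n → Fin n → ℕ) →
              (∑[ v < n ] ∑³ (f v)) ≡ ∑³ (λ i j k → ∑[ v < n ] f v i j k)
  ∑-∑³-comm f = trans (∑-comm {n} {n} _) (sum-cong-≗ {n} λ i →
    trans (∑-comm {n} {n} _) (sum-cong-≗ {n} λ j → ∑-comm {n} {n} _))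

-- In the identities proved by the ring solver below, x ^ 2 and x ^ 3 appear
-- in their definitional unfoldings x * (x * 1) and x * (x * (x * 1)), since
-- the solver does not treat _^_.

-- The guarantee of greedy triangle deletion: starting from s vertices that
-- span τ triangles, it ends with a triangle-free set of size a such that
-- s ≤ a + τ (at most one vertex per triangle is deleted) and, in the dense
-- regime s ≤ 3τ, a ≥ (2/3)·s·√(s/3τ), i.e. 4s³ ≤ 27τa².
Bound : ℕ → ℕ → ℕ → Set
Bound s τ a = s ≤ a + τ × (s ≤ 3 * τ → 4 * s ^ 3 ≤ 27 * τ * a ^ 2)

bound-trivial : ∀ s → Bound s 0 s
bound-trivial s = m≤m+n s 0 , λ s≤0 → ≤-reflexive (cong (λ x → 4 * x ^ 3) (n≤0⇒n≡0 s≤0))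

-- If deleting a vertex from s vertices destroys at least 3τ/s of the τ
-- triangles, the density τ/s³ does not increase.
cube-decay : ∀ s' τ' τ → suc s' * τ' + 3 * τ ≤ suc s' * τ → suc s' ^ 3 * τ' ≤ s' ^ 3 * τ
cube-decay s' τ' τ decay = +-cancelʳ-≤ (3 * (s ^ 2 * τ)) _ _ (begin
  s ^ 3 * τ' + 3 * (s ^ 2 * τ)   ≡⟨ expand s τ' τ ⟩
  s ^ 2 * (s * τ' + 3 * τ)       ≤⟨ *-monoʳ-≤ (s ^ 2) decay ⟩
  s ^ 2 * (s * τ)                ≡⟨ regroup s τ ⟩
  s ^ 3 * τ                      ≤⟨ *-monoˡ-≤ τ cube-step ⟩
  (s' ^ 3 + 3 * s ^ 2) * τ       ≡⟨ distribute s' s τ ⟩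
  s' ^ 3 * τ + 3 * (s ^ 2 * τ)   ∎)
  where
    open ≤-Reasoning
    s = suc s'
    cube-step : s ^ 3 ≤ s' ^ 3 + 3 * s ^ 2
    cube-step = ≤-trans (m≤m+n (s ^ 3) (3 * s' + 2)) (≤-reflexive (binomial s'))
      where
        binomial : ∀ m → suc m * (suc m * (suc m * 1)) + (3 * m + 2) ≡ m * (m * (m * 1)) + 3 * (suc m * (suc m * 1))
        binomial = solve-∀
    expand : ∀ s x τ → s * (s * (s * 1)) * x + 3 * (s * (s * 1) * τ) ≡ s * (s * 1) * (s * x + 3 * τ)
    expand = solve-∀
    regroup : ∀ s τ → s * (s * 1) * (s * τ) ≡ s * (s * (s * 1)) * τ
    regroup = solve-∀
    distribute : ∀ m s τ → (m * (m * (m * 1)) + 3 * (s * (s * 1))) * τ ≡ m * (m * (m * 1)) * τ + 3 * (s * (s * 1) * τ)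
    distribute = solve-∀

cube-bound-transfer : ∀ s s' τ' τ a .{{_ : NonZero τ'}} → s ^ 3 * τ' ≤ s' ^ 3 * τ →
  4 * s' ^ 3 ≤ 27 * τ' * a ^ 2 → 4 * s ^ 3 ≤ 27 * τ * a ^ 2
cube-bound-transfer s s' τ' τ a density bound = *-cancelˡ-≤ τ' (begin
  τ' * (4 * s ^ 3)          ≡⟨ swap₁ τ' s ⟩
  4 * (s ^ 3 * τ')          ≤⟨ *-monoʳ-≤ 4 density ⟩
  4 * (s' ^ 3 * τ)          ≡⟨ swap₂ s' τ ⟩
  τ * (4 * s' ^ 3)          ≤⟨ *-monoʳ-≤ τ bound ⟩
  τ * (27 * τ' * a ^ 2)     ≡⟨ swap₃ τ τ' a ⟩
  τ' * (27 * τ * a ^ 2)     ∎)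
  where
    open ≤-Reasoning
    swap₁ : ∀ x s → x * (4 * (s * (s * (s * 1)))) ≡ 4 * (s * (s * (s * 1)) * x)
    swap₁ = solve-∀
    swap₂ : ∀ m τ → 4 * (m * (m * (m * 1)) * τ) ≡ τ * (4 * (m * (m * (m * 1))))
    swap₂ = solve-∀
    swap₃ : ∀ τ x a → τ * (27 * x * (a * (a * 1))) ≡ x * (27 * τ * (a * (a * 1)))
    swap₃ = solve-∀

cube-bound-from-size : ∀ s τ a → 2 * s ≤ 3 * a → s ≤ 3 * τ → 4 * s ^ 3 ≤ 27 * τ * a ^ 2
cube-bound-from-size s τ a two-thirds dense = begin
  4 * s ^ 3                  ≡⟨ left s ⟩
  2 * s * (2 * s) * s        ≤⟨ *-mono-≤ (*-mono-≤ two-thirds two-thirds) dense ⟩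
  3 * a * (3 * a) * (3 * τ)  ≡⟨ right a τ ⟩
  27 * τ * a ^ 2             ∎
  where
    open ≤-Reasoning
    left : ∀ s → 4 * (s * (s * (s * 1))) ≡ 2 * s * (2 * s) * s
    left = solve-∀
    right : ∀ a τ → 3 * a * (3 * a) * (3 * τ) ≡ 27 * τ * (a * (a * 1))
    right = solve-∀

slack⇒two-thirds : ∀ s' τ' a → s' ≤ a + τ' → 3 * τ' + 2 ≤ s' → 2 * suc s' ≤ 3 * a
slack⇒two-thirds s' τ' a cover slack = +-cancelʳ-≤ s' _ _ (begin
  2 * suc s' + s'       ≡⟨ lhs s' ⟩
  3 * s' + 2            ≤⟨ +-monoˡ-≤ 2 (*-monoʳ-≤ 3 cover) ⟩
  3 * (a + τ') + 2      ≡⟨ rhs a τ' ⟩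
  3 * a + (3 * τ' + 2)  ≤⟨ +-monoʳ-≤ (3 * a) slack ⟩
  3 * a + s'            ∎)
  where
    open ≤-Reasoning
    lhs : ∀ m → 2 * suc m + m ≡ 3 * m + 2
    lhs = solve-∀
    rhs : ∀ a x → 3 * (a + x) + 2 ≡ 3 * a + (3 * x + 2)
    rhs = solve-∀

-- The boundary case s' = 3τ' + 1 (with τ' = y + 1), where the deletion rate
-- itself must be used: (s − 3)τ ≥ sτ' and a ≥ 2τ' + 1.
cube-bound-at-boundary : ∀ y τ a → let s = suc (3 * suc y + 1) in
  s * suc y + 3 * τ ≤ s * τ → 3 * suc y + 1 ≤ a + suc y → 4 * s ^ 3 ≤ 27 * τ * a ^ 2
cube-bound-at-boundary y τ a decay cover = *-cancelˡ-≤ k (begin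
  k * (4 * s ^ 3)                       ≡⟨ reorder s k ⟩
  s * (4 * s ^ 2 * k)                   ≤⟨ *-monoʳ-≤ s polynomial ⟩
  s * (27 * x * (2 * y + 3) ^ 2)        ≡⟨ regroup s x y ⟩
  27 * (s * x) * (2 * y + 3) ^ 2        ≤⟨ *-monoˡ-≤ ((2 * y + 3) ^ 2) (*-monoʳ-≤ 27 rate) ⟩
  27 * (k * τ) * (2 * y + 3) ^ 2        ≤⟨ *-monoʳ-≤ (27 * (k * τ)) (^-monoˡ-≤ 2 kept) ⟩
  27 * (k * τ) * a ^ 2                  ≡⟨ collect k τ a ⟩
  k * (27 * τ * a ^ 2)                  ∎)
  where
    open ≤-Reasoning
    s = suc (3 * suc y + 1)
    x = suc y
    k = 2 + 3 * y
    rate : s * x ≤ k * τ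
    rate = +-cancelʳ-≤ (3 * τ) _ _ (≤-trans decay (≤-reflexive (split y τ)))
      where
        split : ∀ y τ → suc (3 * suc y + 1) * τ ≡ (2 + 3 * y) * τ + 3 * τ
        split = solve-∀
    kept : 2 * y + 3 ≤ a
    kept = +-cancelʳ-≤ x _ _ (≤-trans (≤-reflexive (regroup-cover y)) cover)
      where
        regroup-cover : ∀ y → 2 * y + 3 + suc y ≡ 3 * suc y + 1
        regroup-cover = solve-∀
    polynomial : 4 * s ^ 2 * k ≤ 27 * x * (2 * y + 3) ^ 2
    polynomial = ≤-trans (m≤m+n _ (27 * y + 43)) (≤-reflexive (expansion y))
      where
        expansion : ∀ y → 4 * (suc (3 * suc y + 1) * (suc (3 * suc y + 1) * 1)) * (2 + 3 * y) + (27 * y + 43)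
                          ≡ 27 * suc y * ((2 * y + 3) * ((2 * y + 3) * 1))
        expansion = solve-∀
    reorder : ∀ s k → k * (4 * (s * (s * (s * 1)))) ≡ s * (4 * (s * (s * 1)) * k)
    reorder = solve-∀
    regroup : ∀ s x y → s * (27 * x * ((2 * y + 3) * ((2 * y + 3) * 1)))
                        ≡ 27 * (s * x) * ((2 * y + 3) * ((2 * y + 3) * 1))
    regroup = solve-∀
    collect : ∀ k τ a → 27 * (k * τ) * (a * (a * 1)) ≡ k * (27 * τ * (a * (a * 1)))
    collect = solve-∀

squeezed : ∀ m n → ¬ m ≤ n → ¬ n + 2 ≤ m → m ≡ n + 1
squeezed m n m≰n n+2≰m = ≤-antisym
  (m<1+n⇒m≤n (subst (m <_) (+-suc n 1) (≰⇒> n+2≰m)))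
  (subst (_≤ m) (+-comm 1 n) (≰⇒> m≰n))

-- Either the
-- smaller instance is still dense (its bound transfers), or it has at least
-- two vertices more than 3τ' (so a ≥ 2s/3), or it sits exactly at the boundary.
cube-bound-step : ∀ s' τ' τ a → suc s' * τ' + 3 * τ ≤ suc s' * τ → suc s' ≤ 3 * τ → s' ≤ a + τ' →
  (s' ≤ 3 * τ' → 4 * s' ^ 3 ≤ 27 * τ' * a ^ 2) → 4 * suc s' ^ 3 ≤ 27 * τ * a ^ 2
cube-bound-step s' zero τ a decay dense cover _ with 2 ≤? s'
... | yes slack = cube-bound-from-size (suc s') τ a (slack⇒two-thirds s' 0 a cover slack) dense
... | no s'<2 = ⊥-elim (<⇒≱ (≤-trans dense (*-monoʳ-≤ 3 τ≤0)) z≤n)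
  where
    -- with s ≤ 2 and τ' = 0 the deletion rate forces 3τ ≤ 2τ
    τ≤0 : τ ≤ 0
    τ≤0 = +-cancelʳ-≤ (2 * τ) τ 0 (begin
      3 * τ                   ≡⟨ cong (_+ 3 * τ) (*-zeroʳ (suc s')) ⟨
      suc s' * 0 + 3 * τ      ≤⟨ decay ⟩
      suc s' * τ              ≤⟨ *-monoˡ-≤ τ (≰⇒> s'<2) ⟩
      2 * τ                   ∎)
      where open ≤-Reasoning
cube-bound-step s' τ'@(suc x) τ a decay dense cover ih with s' ≤? 3 * τ'
... | yes sparse = cube-bound-transfer (suc s') s' τ' τ a (cube-decay s' τ' τ decay) (ih sparse)
... | no ¬sparse with 3 * τ' + 2 ≤? s'
...   | yes slack = cube-bound-from-size (suc s') τ a (slack⇒two-thirds s' τ' a cover slack) dense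
...   | no ¬slack with squeezed s' (3 * τ') ¬sparse ¬slack
...     | refl = cube-bound-at-boundary x τ a decay cover

bound-step : ∀ {s' τ' τ d a} → 0 < d → τ' + d ≡ τ → 3 * τ ≤ suc s' * d →
  Bound s' τ' a → Bound (suc s') τ a
bound-step {s'} {τ'} {τ} {d} {a} d>0 split heavy (cover , cube) =
  cover′ , λ dense → cube-bound-step s' τ' τ a decay dense cover cube
  where
    open ≤-Reasoning
    cover′ : suc s' ≤ a + τ
    cover′ = begin
      suc s'           ≤⟨ s≤s cover ⟩
      suc (a + τ')     ≡⟨ +-suc a τ' ⟨
      a + (1 + τ')     ≤⟨ +-monoʳ-≤ a (≤-trans (≤-reflexive (+-comm 1 τ')) (+-monoʳ-≤ τ' d>0)) ⟩
      a + (τ' + d)     ≡⟨ cong (a +_) split ⟩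
      a + τ            ∎
    decay : suc s' * τ' + 3 * τ ≤ suc s' * τ
    decay = begin
      suc s' * τ' + 3 * τ        ≤⟨ +-monoʳ-≤ (suc s' * τ') heavy ⟩
      suc s' * τ' + suc s' * d   ≡⟨ *-distribˡ-+ (suc s') τ' d ⟨
      suc s' * (τ' + d)          ≡⟨ cong (suc s' *_) split ⟩
      suc s' * τ                 ∎

positive-factors : ∀ {τ s d} → τ ≢ 0 → 3 * τ ≤ s * d → 0 < s × 0 < d
positive-factors {τ} {zero}          τ≢0 le = ⊥-elim (τ≢0 (n≤0⇒n≡0 (≤-trans (m≤m+n τ (2 * τ)) le)))
positive-factors {τ} {suc s} {zero}  τ≢0 le =
  ⊥-elim (τ≢0 (n≤0⇒n≡0 (≤-trans (m≤m+n τ (2 * τ)) (≤-trans le (≤-reflexive (*-zeroʳ (suc s)))))))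
positive-factors {τ} {suc s} {suc d} _   _  = z<s , z<s

χ : ∀ {n} → Subset n → Fin n → ℕ
χ S i = ⟦ lookup S i ⟧

∣∣≡∑χ : ∀ {n} (S : Subset n) → ∣ S ∣ ≡ ∑[ i < n ] χ S i
∣∣≡∑χ []          = refl
∣∣≡∑χ (true ∷ S)  = cong suc (∣∣≡∑χ S)
∣∣≡∑χ (false ∷ S) = ∣∣≡∑χ S

∣∣-delete : ∀ {n} (S : Subset n) v → lookup S v ≡ true → ∣ S ∣ ≡ suc ∣ S [ v ]≔ false ∣
∣∣-delete (true ∷ S)  fzero    refl = refl
∣∣-delete (true ∷ S)  (fsuc v) v∈S  = cong suc (∣∣-delete S v v∈S)
∣∣-delete (false ∷ S) (fsuc v) v∈S  = ∣∣-delete S v v∈S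

-- A 3-uniform weighted hypergraph on Fin n: t i j k is the weight of the
-- triple {i, j, k}, recorded only for i < j < k.
module TripleCount {n : ℕ} (t : Fin n → Fin n → Fin n → ℕ)
    (t-increasing : ∀ {i j k} → t i j k ≢ 0 → toℕ i < toℕ j × toℕ j < toℕ k) where

  weight : Subset n → Fin n → Fin n → Fin n → ℕ
  weight S i j k = χ S i * χ S j * χ S k * t i j k

  τ : Subset n → ℕ
  τ S = ∑³ (weight S)

  hits : Fin n → Fin n → Fin n → Fin n → ℕ
  hits v i j k = δ i v + δ j v + δ k v

  deg : Subset n → Fin n → ℕ
  deg S v = ∑³ λ i j k → hits v i j k * weight S i j k

  -- arithmetic shape of weight-delete when v is hit once and the deleted
  -- weight vanishes because of the factor a = 0
  one-hit : ∀ {a} b w → a ≡ 0 → w ≡ a * b + 1 * w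
  one-hit b w refl = sym (+-identityʳ w)

  -- Deleting v removes exactly the weight of the triples through v: a triple
  -- of positive weight has distinct coordinates, so it hits v at most once.
  weight-delete : ∀ S v i j k →
    weight S i j k ≡ weight (S [ v ]≔ false) i j k + hits v i j k * weight S i j k
  weight-delete S v i j k with t i j k ≟ 0
  ... | yes t≡0 rewrite t≡0 | *-zeroʳ (χ S i * χ S j * χ S k)
                          | *-zeroʳ (χ (S [ v ]≔ false) i * χ (S [ v ]≔ false) j * χ (S [ v ]≔ false) k)
                          | *-zeroʳ (hits v i j k) = refl
  ... | no t≢0 with i Fin.≟ v | j Fin.≟ v | k Fin.≟ v | t-increasing t≢0
  ...   | yes refl | yes refl | _        | i<j , _   = ⊥-elim (<-irrefl refl i<j)
  ...   | yes refl | _        | yes refl | i<j , j<k = ⊥-elim (<-irrefl refl (<-trans i<j j<k))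
  ...   | _        | yes refl | yes refl | _ , j<k   = ⊥-elim (<-irrefl refl j<k)
  ...   | yes refl | no j≢v   | no k≢v   | _ rewrite lookup∘update v S false =
    sym (+-identityʳ _)
  ...   | no i≢v   | yes refl | no k≢v   | _ rewrite lookup∘update v S false =
    one-hit _ _ (cong (_* χ (S [ v ]≔ false) k) (*-zeroʳ (χ (S [ v ]≔ false) i)))
  ...   | no i≢v   | no j≢v   | yes refl | _ rewrite lookup∘update v S false =
    one-hit _ _ (*-zeroʳ (χ (S [ v ]≔ false) i * χ (S [ v ]≔ false) j))
  ...   | no i≢v   | no j≢v   | no k≢v   | _
    rewrite lookup∘update′ i≢v S false | lookup∘update′ j≢v S false | lookup∘update′ k≢v S false =
    sym (+-identityʳ _)

  τ-delete : ∀ S v → τ S ≡ τ (S [ v ]≔ false) + deg S v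
  τ-delete S v = trans (∑³-cong (weight-delete S v))
    (∑³-distrib-+ (weight (S [ v ]≔ false)) (λ i j k → hits v i j k * weight S i j k))

  -- A non-member has degree 0, since deleting it changes nothing.
  deg-outside : ∀ S v → lookup S v ≡ false → deg S v ≡ 0
  deg-outside S v v∉S = +-cancelˡ-≡ (τ S) (deg S v) 0 (begin
    τ S + deg S v                    ≡⟨ cong (λ S′ → τ S′ + deg S v) unchanged ⟨
    τ (S [ v ]≔ false) + deg S v     ≡⟨ τ-delete S v ⟨
    τ S                              ≡⟨ +-identityʳ (τ S) ⟨
    τ S + 0                          ∎)
    where
      open ≡-Reasoning
      unchanged : S [ v ]≔ false ≡ S
      unchanged = trans (cong (S [ v ]≔_) (sym v∉S)) ([]≔-lookup S v)

  -- Every triple is counted three times in the degree sum.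
  ∑-deg : ∀ S → (∑[ v < n ] deg S v) ≡ 3 * τ S
  ∑-deg S = begin
    (∑[ v < n ] deg S v)
      ≡⟨ ∑-∑³-comm (λ v i j k → hits v i j k * weight S i j k) ⟩
    ∑³ (λ i j k → ∑[ v < n ] (hits v i j k * weight S i j k))
      ≡⟨ ∑³-cong (λ i j k → *-distribʳ-sum {n} (weight S i j k) (hits′ i j k)) ⟨
    ∑³ (λ i j k → (∑[ v < n ] hits v i j k) * weight S i j k)
      ≡⟨ ∑³-cong (λ i j k → cong (_* weight S i j k) (∑-hits i j k)) ⟩
    ∑³ (λ i j k → 3 * weight S i j k)
      ≡⟨ ∑³-distribˡ-* 3 (weight S) ⟩
    3 * τ S
      ∎
    where
      open ≡-Reasoning
      hits′ : Fin n → Fin n → Fin n → Fin n → ℕ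
      hits′ i j k v = hits v i j k
      ∑-hits : ∀ i j k → (∑[ v < n ] hits v i j k) ≡ 3
      ∑-hits i j k = trans (∑-distrib-+ {n} _ _)
        (cong₂ _+_ (trans (∑-distrib-+ {n} _ _) (cong₂ _+_ (∑-δ i) (∑-δ j))) (∑-δ k))

  -- Averaging: if τ S > 0, a vertex of maximum degree has degree ≥ 3τ/|S|.
  heavy-vertex : ∀ S → τ S ≢ 0 → ∃ λ v → 3 * τ S ≤ ∣ S ∣ * deg S v
  heavy-vertex S τ≢0
    with maximiser (deg S) (λ ∑≡0 → τ≢0 (m+n≡0⇒m≡0 (τ S) (trans (sym (∑-deg S)) ∑≡0)))
  ... | v , maximal = v , (begin
    3 * τ S                         ≡⟨ ∑-deg S ⟨
    (∑[ w < n ] deg S w)            ≤⟨ ∑-mono bounded ⟩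
    (∑[ w < n ] (χ S w * deg S v))  ≡⟨ *-distribʳ-sum {n} (deg S v) (χ S) ⟨
    (∑[ w < n ] χ S w) * deg S v    ≡⟨ cong (_* deg S v) (∣∣≡∑χ S) ⟨
    ∣ S ∣ * deg S v                 ∎)
    where
      open ≤-Reasoning
      bounded : ∀ w → deg S w ≤ χ S w * deg S v
      bounded w with lookup S w in w∈?S
      ... | true  = ≤-trans (maximal w) (≤-reflexive (sym (+-identityʳ _)))
      ... | false = ≤-reflexive (deg-outside S w w∈?S)

  positive⇒member : ∀ S v → 0 < deg S v → lookup S v ≡ true
  positive⇒member S v deg>0 with lookup S v in v∈?S
  ... | true  = refl
  ... | false = ⊥-elim (<-irrefl refl (subst (0 <_) (deg-outside S v v∈?S) deg>0))

  greedy : ∀ m (S : Subset n) → ∣ S ∣ ≡ m → ∃ λ A → τ A ≡ 0 × Bound m (τ S) ∣ A ∣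
  greedy m S ∣S∣≡m with τ S ≟ 0
  ... | yes τ≡0 = S , τ≡0 , subst₂ (Bound m) (sym τ≡0) (sym ∣S∣≡m) (bound-trivial m)
  ... | no τ≢0 with heavy-vertex S τ≢0
  ...   | v , heavy with subst (λ s → 3 * τ S ≤ s * deg S v) ∣S∣≡m heavy
  ...     | heavy′ with positive-factors {s = m} {d = deg S v} τ≢0 heavy′
  greedy zero    S _ | no _ | _ | _ | () , _
  greedy (suc m) S ∣S∣≡m | no τ≢0 | v , _ | heavy′ | _ , deg>0
    with greedy m (S [ v ]≔ false)
           (suc-injective (trans (sym (∣∣-delete S v (positive⇒member S v deg>0))) ∣S∣≡m))
  ... | A , τA≡0 , bound = A , τA≡0 , bound-step deg>0 (sym (τ-delete S v)) heavy′ bound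

<⇒<ᵇ≡true : ∀ {m n} → m < n → (m <ᵇ n) ≡ true
<⇒<ᵇ≡true = Equivalence.to T-≡ ∘ <⇒<ᵇ

<ᵇ≡true⇒< : ∀ {m n} → (m <ᵇ n) ≡ true → m < n
<ᵇ≡true⇒< {m} {n} = <ᵇ⇒< m n ∘ Equivalence.from T-≡

module _ {n : ℕ} (P : Fin n → Fin n → Fin n → Set)
    (swap₁₂ : ∀ {a b c} → P a b c → P b a c) (swap₂₃ : ∀ {a b c} → P a b c → P a c b) where

  sorted-only : (∀ {i j k} → toℕ i < toℕ j → toℕ j < toℕ k → ¬ P i j k) →
                ∀ {a b c} → a ≢ b → b ≢ c → a ≢ c → ¬ P a b c
  sorted-only none {a} {b} {c} a≢b b≢c a≢c p with Fin.<-cmp a b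
  ... | tri≈ _ a≡b _ = a≢b a≡b
  ... | tri< a<b _ _ with Fin.<-cmp b c
  ...   | tri≈ _ b≡c _ = b≢c b≡c
  ...   | tri< b<c _ _ = none a<b b<c p
  ...   | tri> _ _ c<b with Fin.<-cmp a c
  ...     | tri≈ _ a≡c _ = a≢c a≡c
  ...     | tri< a<c _ _ = none a<c c<b (swap₂₃ p)
  ...     | tri> _ _ c<a = none c<a a<b (swap₁₂ (swap₂₃ p))
  sorted-only none {a} {b} {c} a≢b b≢c a≢c p | tri> _ _ b<a with Fin.<-cmp a c
  ...   | tri≈ _ a≡c _ = a≢c a≡c
  ...   | tri< a<c _ _ = none b<a a<c (swap₁₂ p)
  ...   | tri> _ _ c<a with Fin.<-cmp b c
  ...     | tri≈ _ b≡c _ = b≢c b≡c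
  ...     | tri< b<c _ _ = none b<c c<a (swap₂₃ (swap₁₂ p))
  ...     | tri> _ _ c<b = none c<b b<a (swap₁₂ (swap₂₃ (swap₁₂ p)))

true≢false : true ≢ false
true≢false ()

∧-rotate : ∀ x y z → x ∧ y ∧ z ≡ y ∧ z ∧ x
∧-rotate x y z = trans (∧-comm x (y ∧ z)) (∧-assoc y z x)

module _ {n : ℕ} (T : Tournament n) where

  triangleAt : Fin n → Fin n → Fin n → ℕ
  triangleAt i j k = ⟦ (toℕ i <ᵇ toℕ j) ∧ (toℕ j <ᵇ toℕ k) ∧ isDirTriangle T i j k ⟧

  triangleAt-increasing : ∀ {i j k} → triangleAt i j k ≢ 0 → toℕ i < toℕ j × toℕ j < toℕ k
  triangleAt-increasing {i} {j} {k} t≢0 with toℕ i <ᵇ toℕ j in i<j | toℕ j <ᵇ toℕ k in j<k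
  ... | true  | true  = <ᵇ≡true⇒< i<j , <ᵇ≡true⇒< j<k
  ... | true  | false = ⊥-elim (t≢0 refl)
  ... | false | _     = ⊥-elim (t≢0 refl)

  open TripleCount triangleAt triangleAt-increasing public

  τ-full : τ ⊤ ≡ triangles T
  τ-full = begin
    τ ⊤             ≡⟨ ∑³-cong full-weight ⟩
    ∑³ triangleAt   ≡⟨ listsums ⟨
    triangles T     ∎
    where
      open ≡-Reasoning
      full-weight : ∀ i j k → weight ⊤ i j k ≡ triangleAt i j k
      full-weight i j k rewrite lookup-replicate i true | lookup-replicate j true
                              | lookup-replicate k true = +-identityʳ (triangleAt i j k)
      listsums : triangles T ≡ ∑³ triangleAt
      listsums = trans (listsum-allFin (λ i → listsum² (triangleAt i))) (sum-cong-≗ {n} λ i →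
        trans (listsum-allFin (λ j → listsum¹ (triangleAt i j))) (sum-cong-≗ {n} λ j →
          listsum-allFin (triangleAt i j)))
        where
          listsum¹ : (Fin n → ℕ) → ℕ
          listsum¹ f = ListSum.sum (List.map f (List.allFin n))
          listsum² : (Fin n → Fin n → ℕ) → ℕ
          listsum² f = listsum¹ (λ j → listsum¹ (f j))

  dir-swap₁₂ : ∀ i j k → isDirTriangle T j i k ≡ isDirTriangle T i j k
  dir-swap₁₂ i j k = trans
    (cong₂ _∨_ (∧-rotate (arc T j i) (arc T i k) (arc T k j)) (sym (∧-rotate (arc T i j) (arc T j k) (arc T k i))))
    (∨-comm (arc T i k ∧ arc T k j ∧ arc T j i) (arc T i j ∧ arc T j k ∧ arc T k i))

  dir-swap₂₃ : ∀ i j k → isDirTriangle T i k j ≡ isDirTriangle T i j k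
  dir-swap₂₃ i j k = ∨-comm (arc T i k ∧ arc T k j ∧ arc T j i) (arc T i j ∧ arc T j k ∧ arc T k i)

  InTriangle : Subset n → Fin n → Fin n → Fin n → Set
  InTriangle A a b c = a ∈ A × b ∈ A × c ∈ A × isDirTriangle T a b c ≡ true

  sorted-free : ∀ A → τ A ≡ 0 → ∀ {i j k} → toℕ i < toℕ j → toℕ j < toℕ k → ¬ InTriangle A i j k
  sorted-free A τ≡0 {i} {j} {k} i<j j<k (i∈A , j∈A , k∈A , directed)
    with ∑³≡0⇒≡0 (weight A) τ≡0 i j k
  ... | w≡0 rewrite []=⇒lookup i∈A | []=⇒lookup j∈A | []=⇒lookup k∈A
                  | <⇒<ᵇ≡true i<j | <⇒<ᵇ≡true j<k | directed with () ← w≡0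

  triangle-free : ∀ A → τ A ≡ 0 → ∀ {a b c} → a ≢ b → b ≢ c → a ≢ c → ¬ InTriangle A a b c
  triangle-free A τ≡0 = sorted-only (InTriangle A)
    (λ { {a} {b} {c} (a∈ , b∈ , c∈ , d) → b∈ , a∈ , c∈ , trans (dir-swap₁₂ a b c) d })
    (λ { {a} {b} {c} (a∈ , b∈ , c∈ , d) → a∈ , c∈ , b∈ , trans (dir-swap₂₃ a b c) d })
    (sorted-free A τ≡0)

  transitive : ∀ A → τ A ≡ 0 → ∀ {u w v} → u ∈ A → w ∈ A → v ∈ A →
               arc T u w ≡ true → arc T w v ≡ true → arc T u v ≡ true
  transitive A τ≡0 {u} {w} {v} u∈A w∈A v∈A u→w w→v with u Fin.≟ v
  ... | yes refl = ⊥-elim (true≢false (trans (sym w→v) (antisym T u w u→w)))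
  ... | no u≢v with total T u v u≢v
  ...   | inj₁ u→v = u→v
  ...   | inj₂ v→u = ⊥-elim (triangle-free A τ≡0 (loopless u→w) (loopless w→v) u≢v
                               (u∈A , w∈A , v∈A , cycle))
    where
      loopless : ∀ {x y} → arc T x y ≡ true → x ≢ y
      loopless {x} x→y refl = true≢false (trans (sym x→y) (irrefl T x))
      cycle : isDirTriangle T u w v ≡ true
      cycle rewrite u→w | w→v | v→u = refl

  -- A walk inside such a set can be shortcut to a single arc ...
  walk⇒arc : ∀ A → τ A ≡ 0 → ∀ {u v} → WalkIn T A u v → u ∈ A × v ∈ A × arc T u v ≡ true
  walk⇒arc A τ≡0 (edge u∈A v∈A u→v) = u∈A , v∈A , u→v
  walk⇒arc A τ≡0 (step u∈A u→w walk) with walk⇒arc A τ≡0 walk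
  ... | w∈A , v∈A , w→v = u∈A , v∈A , transitive A τ≡0 u∈A w∈A v∈A u→w w→v

  -- ... so a closed walk would be a loop.
  triangle-free⇒acyclic : ∀ A → τ A ≡ 0 → Acyclic T A
  triangle-free⇒acyclic A τ≡0 (u , closed) =
    true≢false (trans (sym (proj₂ (proj₂ (walk⇒arc A τ≡0 closed)))) (irrefl T u))

mainTheorem4 : (n : ℕ) (T : Tournament n) (a : ℕ) → IsAlpha T a →
    n ≤ 3 * triangles T →
    4 * n ^ 3 ≤ 27 * triangles T * a ^ 2
mainTheorem4 n T a (_ , maximum) dense with greedy T n ⊤ (∣⊤∣≡n n)
... | A , τA≡0 , _ , cube = begin
  4 * n ^ 3                     ≤⟨ subst (λ t → 4 * n ^ 3 ≤ 27 * t * ∣ A ∣ ^ 2) (τ-full T)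
                                     (cube (subst (λ t → n ≤ 3 * t) (sym (τ-full T)) dense)) ⟩
  27 * triangles T * ∣ A ∣ ^ 2  ≤⟨ *-monoʳ-≤ (27 * triangles T)
                                     (^-monoˡ-≤ 2 (maximum A (triangle-free⇒acyclic T A τA≡0))) ⟩
  27 * triangles T * a ^ 2      ∎
  where open ≤-Reasoning
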